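{- Let $G$ be a finite cyclic group. Then $\mathcal{P}^{**}(G)$ does not contain the graph $\Gamma_2$ as an induced subgraph if and only if $G$ is one of: (a) $\mathbb{Z}_{p^t}$; (b) $\mathbb{Z}_{pq}$; (c) $\mathbb{Z}_{12}$; (d) $\mathbb{Z}_{18}$, where $p,q$ are distinct primes and $t\geq 1$.
   Context: For a finite group $G$, the power graph $\mathcal{P}(G)$ is the simple graph with vertex set $G$ in which two distinct vertices $u,v$ are adjacent iff $u^m=v$ or $v^n=u$ for some positive integers $m,n$. The proper power graph $\mathcal{P}^{**}(G)$ is obtained from $\mathcal{P}(G)$ by deleting all dominating vertices (vertices adjacent to all other vertices). $\Gamma_2$ is the graph on $5$ vertices obtained from the complete graph $K_5$ by deleting one edge. -}

module Defs where

open import Data.Nat using (ℕ; zero; suc; _+_; _*_; _^_; _≤_; NonZero)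
open import Data.Nat.DivMod using (_%_)
open import Data.Nat.Primality using (Prime)
open import Data.Fin using (Fin; toℕ)
open import Data.Product using (Σ; _×_; ∃-syntax)
open import Data.Sum using (_⊎_)
open import Relation.Binary.PropositionalEquality using (_≡_; _≢_)

-- The finite cyclic group of order n is modelled as ℤ_n = Fin n under
-- addition modulo n.  In additive notation the power u^m is m·u (mod n).
power : (n : ℕ) → .{{_ : NonZero n}} → ℕ → Fin n → ℕ
power n m u = (m * toℕ u) % n

Adj : (n : ℕ) → .{{_ : NonZero n}} → Fin n → Fin n → Set
Adj n u v =
  u ≢ v ×
  ((∃[ m ] (1 ≤ m × power n m u ≡ toℕ v)) ⊎
   (∃[ m ] (1 ≤ m × power n m v ≡ toℕ u)))

Dominating : (n : ℕ) → .{{_ : NonZero n}} → Fin n → Set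
Dominating n v = (w : Fin n) → w ≢ v → Adj n v w

-- Edges of Γ₂ = K₅ minus one edge, on vertex set Fin 5; the deleted edge is {0,1}.
-- Γ₂-Edge i j holds iff i ≠ j and {i,j} ≠ {0,1}.
Γ₂-Edge : Fin 5 → Fin 5 → Set
Γ₂-Edge i j = i ≢ j × ¬01 i j
  where
  ¬01 : Fin 5 → Fin 5 → Set
  ¬01 i j = (toℕ i ≡ 0 × toℕ j ≡ 1 → Data.Empty.⊥) × (toℕ i ≡ 1 × toℕ j ≡ 0 → Data.Empty.⊥)
    where import Data.Empty

-- P**(ℤ_n) contains Γ₂ as an induced subgraph: there is an injective map
-- f : Fin 5 → ℤ_n into the non-dominating vertices such that, for distinct
-- i, j, f i and f j are adjacent in the power graph iff {i,j} is an edge of Γ₂.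
-- (P** is the induced subgraph of P on the non-dominating vertices.)
ContainsΓ₂ : (n : ℕ) → .{{_ : NonZero n}} → Set
ContainsΓ₂ n =
  Σ (Fin 5 → Fin n) λ f →
    ((i j : Fin 5) → f i ≡ f j → i ≡ j) ×
    ((i : Fin 5) → Dominating n (f i) → Data.Empty.⊥) ×
    ((i j : Fin 5) → i ≢ j →
       (Adj n (f i) (f j) → Γ₂-Edge i j) × (Γ₂-Edge i j → Adj n (f i) (f j)))
  where import Data.Empty

Exceptional : ℕ → Set
Exceptional n =
  (∃[ p ] ∃[ t ] (Prime p × 1 ≤ t × n ≡ p ^ t)) ⊎
  (∃[ p ] ∃[ q ] (Prime p × Prime q × p ≢ q × n ≡ p * q)) ⊎
  n ≡ 12 ⊎
  n ≡ 18

-- In ℤ_n, v is a positive multiple of u iff gcd(u,n) ∣ v (Bézout), so u and v are adjacent in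
-- P(ℤ_n) iff the divisors gcd(u,n) and gcd(v,n) of n are comparable under divisibility.
-- If n = p^t these divisors form a chain and every vertex dominates.  If n = pq, a
-- non-dominating vertex has gcd p or q, and adjacent non-dominating vertices share it, so the
-- two non-adjacent vertices of Γ₂ would be adjacent through a common neighbour; ℤ₁₂ and ℤ₁₈
-- are checked exhaustively.  Every other n is p·N with distinct primes a, b dividing N and
-- b ≠ p, and then p·a, p·b, p, −p and p·c induce Γ₂ inside the subgroup pℤ_n, where c = a·b if
-- a·b is a proper divisor of N, and otherwise c ∈ {2, 3} is a unit modulo N = a·b ≠ 6.
module Submission where

open import Defs
open import Data.Empty using (⊥; ⊥-elim)
open import Data.Fin using (Fin; toℕ; fromℕ<)
open import Data.Fin.Patterns using (0F; 1F; 2F; 3F; 4F)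
import Data.Fin.Properties as Fin
open import Data.List using ([]; _∷_)
open import Data.List.Relation.Unary.All using (_∷_)
open import Data.Nat
  using (ℕ; zero; suc; pred; _+_; _*_; _^_; _≤_; _<_; _≟_; NonZero; >-nonZero⁻¹; ≢-nonZero;
         ≢-nonZero⁻¹; nonTrivial⇒n>1; s≤s; s≤s⁻¹; z≤n)
open import Data.Nat.Coprimality using (Coprime; coprime-divisor; coprime⇒gcd≡1)
open import Data.Nat.Divisibility
open import Data.Nat.DivMod
open import Data.Nat.GCD
  using (gcd; gcd[m,n]∣m; gcd[m,n]∣n; gcd-greatest; gcd-comm; gcd-GCD; module Bézout)
open import Data.Nat.Induction using (<-rec)
open import Data.Nat.ListAction using (product)
open import Data.Nat.Primality
  using (Prime; prime?; prime[2]; ¬prime[1]; euclidsLemma; prime⇒irreducible; prime⇒nonZero;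
         prime⇒nonTrivial)
open import Data.Nat.Primality.Factorisation using (factorise)
open import Data.Nat.Properties
open import Data.Nat.Tactic.RingSolver using (solve-∀)
open import Data.Product using (Σ-syntax; ∃-syntax; _×_; _,_; proj₁; proj₂; swap; curry)
open import Data.Sum as Sum using (_⊎_; inj₁; inj₂)
open import Function using (_∘_; id)
open import Relation.Binary.PropositionalEquality
open import Relation.Nullary using (¬_; Dec; yes; no; ¬?; _×-dec_; _⊎-dec_; _→-dec_)
open import Relation.Nullary.Decidable using (toWitness)

bézout-% : ∀ n .{{_ : NonZero n}} x → ∃[ m ] ((m * x) % n ≡ gcd x n % n)
bézout-% n x with Bézout.identity (gcd-GCD x n)
... | Bézout.+- m k eq = m , (begin
  (m * x) % n           ≡⟨ cong (_% n) eq ⟨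
  (gcd x n + k * n) % n ≡⟨ [m+kn]%n≡m%n (gcd x n) k n ⟩
  gcd x n % n           ∎)
  where open ≡-Reasoning
-- Here m·x ≡ −gcd(x, n) (mod n), and n − 1 ≡ −1.
bézout-% n@(suc n-1) x | Bézout.-+ m k eq = n-1 * m , (begin
  (n-1 * m * x) % n                 ≡⟨ [m+kn]%n≡m%n (n-1 * m * x) k n ⟨
  (n-1 * m * x + k * n) % n         ≡⟨ cong (λ r → (n-1 * m * x + r) % n) eq ⟨
  (n-1 * m * x + (g + m * x)) % n   ≡⟨ cong (_% n) (shift n-1 m x g) ⟩
  (g + (m * x) * n) % n             ≡⟨ [m+kn]%n≡m%n g (m * x) n ⟩
  g % n                             ∎)
  where
  open ≡-Reasoning
  g : ℕ
  g = gcd x n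
  shift : ∀ n-1 m x g → n-1 * m * x + (g + m * x) ≡ g + (m * x) * suc n-1
  shift = solve-∀

prime∣prime⇒≡ : ∀ {p q} → Prime p → Prime q → p ∣ q → p ≡ q
prime∣prime⇒≡ p-prime q-prime p∣q with prime⇒irreducible q-prime p∣q
... | inj₁ refl = ⊥-elim (¬prime[1] p-prime)
... | inj₂ p≡q  = p≡q

∤prime⇒coprime : ∀ {p d} → Prime p → p ∤ d → Coprime d p
∤prime⇒coprime p-prime p∤d (c∣d , c∣p) with prime⇒irreducible p-prime c∣p
... | inj₁ c≡1 = c≡1
... | inj₂ refl = ⊥-elim (p∤d c∣d)

∤prime∧∣prime^⇒≡1 : ∀ {p d} → Prime p → p ∤ d → ∀ t → d ∣ p ^ t → d ≡ 1
∤prime∧∣prime^⇒≡1 p-prime p∤d zero    d∣1 = ∣1⇒≡1 d∣1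
∤prime∧∣prime^⇒≡1 p-prime p∤d (suc t) d∣p^t+1 =
  ∤prime∧∣prime^⇒≡1 p-prime p∤d t (coprime-divisor (∤prime⇒coprime p-prime p∤d) d∣p^t+1)

prime^-divisors-chain : ∀ {p} → Prime p → ∀ t {d e} → d ∣ p ^ t → e ∣ p ^ t → d ∣ e ⊎ e ∣ d
prime^-divisors-chain p-prime zero d∣1 e∣1 =
  inj₁ (subst₂ _∣_ (sym (∣1⇒≡1 d∣1)) (sym (∣1⇒≡1 e∣1)) ∣-refl)
prime^-divisors-chain {p} p-prime t@(suc t-1) {d} {e} d∣ e∣ with p ∣? d | p ∣? e
... | no p∤d | _ = inj₁ (subst (_∣ e) (sym (∤prime∧∣prime^⇒≡1 p-prime p∤d t d∣)) (1∣ e))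
... | _ | no p∤e = inj₂ (subst (_∣ d) (sym (∤prime∧∣prime^⇒≡1 p-prime p∤e t e∣)) (1∣ d))
... | yes (divides c refl) | yes (divides c′ refl) =
  Sum.map (*-monoˡ-∣ p) (*-monoˡ-∣ p)
          (prime^-divisors-chain p-prime t-1 (cancel c d∣) (cancel c′ e∣))
  where
  cancel : ∀ c → c * p ∣ p * p ^ t-1 → c ∣ p ^ t-1
  cancel c = *-cancelʳ-∣ p {{prime⇒nonZero p-prime}} ∘ subst (c * p ∣_) (*-comm p (p ^ t-1))

∣p*q⇒prime : ∀ {p q d} → Prime p → Prime q → d ∣ p * q → d ≢ 1 → d ≢ p * q → Prime d
∣p*q⇒prime {p} {q} {d} p-prime q-prime d∣pq d≢1 d≢pq with p ∣? d
... | yes (divides c refl)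
  with prime⇒irreducible q-prime {c}
         (*-cancelʳ-∣ p {{prime⇒nonZero p-prime}} (subst (c * p ∣_) (*-comm p q) d∣pq))
...   | inj₁ refl = subst Prime (sym (*-identityˡ p)) p-prime
...   | inj₂ refl = ⊥-elim (d≢pq (*-comm q p))
∣p*q⇒prime {d = d} p-prime q-prime d∣pq d≢1 d≢pq | no p∤d
  with prime⇒irreducible q-prime {d} (coprime-divisor (∤prime⇒coprime p-prime p∤d) d∣pq)
... | inj₁ d≡1 = ⊥-elim (d≢1 d≡1)
... | inj₂ refl = q-prime

prime-factor : ∀ {m} → 2 ≤ m → ∃[ q ] (Prime q × q ∣ m)
prime-factor {m@(suc _)} 2≤m with factorise m
... | record { factors = [] ; isFactorisation = m≡1 } = ⊥-elim (<⇒≢ 2≤m (sym m≡1))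
... | record { factors = q ∷ qs ; isFactorisation = m≡qΠqs ; factorsPrime = q-prime ∷ _ } =
  q , q-prime , divides (product qs) (trans m≡qΠqs (*-comm q (product qs)))

prime⇒2≤ : ∀ {p} → Prime p → 2 ≤ p
prime⇒2≤ {p} p-prime = nonTrivial⇒n>1 p {{prime⇒nonTrivial p-prime}}

2+factor≤ : ∀ {x y N} .{{_ : NonZero N}} → 2 ≤ x → 2 ≤ y → x * y ∣ N → 2 + x ≤ N
2+factor≤ {x} {y} {N} 2≤x 2≤y xy∣N = begin
  2 + x   ≤⟨ +-monoˡ-≤ x 2≤x ⟩
  x + x   ≡⟨ cong (x +_) (+-identityʳ x) ⟨
  2 * x   ≤⟨ *-monoˡ-≤ x 2≤y ⟩
  y * x   ≡⟨ *-comm y x ⟩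
  x * y   ≤⟨ ∣⇒≤ xy∣N ⟩
  N       ∎
  where open ≤-Reasoning

∤prime⇒unit : ∀ {c N} → 2 ≤ N → Prime c → c ∤ N → ∃[ d ] ∃[ j ] (c * d ≡ j * N + 1)
∤prime⇒unit {c} {N@(suc _)} 2≤N c-prime c∤N with bézout-% N c
... | m , mc≡g = m , (m * c) / N , (begin
  c * m                         ≡⟨ *-comm c m ⟩
  m * c                         ≡⟨ m≡m%n+[m/n]*n (m * c) N ⟩
  (m * c) % N + (m * c) / N * N ≡⟨ cong (_+ (m * c) / N * N) mc%N≡1 ⟩
  1 + (m * c) / N * N           ≡⟨ +-comm 1 _ ⟩
  (m * c) / N * N + 1           ∎)
  where
  open ≡-Reasoning
  mc%N≡1 : (m * c) % N ≡ 1
  mc%N≡1 = begin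
    (m * c) % N ≡⟨ mc≡g ⟩
    gcd c N % N ≡⟨ cong (_% N) (trans (gcd-comm c N) (coprime⇒gcd≡1 (∤prime⇒coprime c-prime c∤N))) ⟩
    1 % N       ≡⟨ m<n⇒m%n≡m 2≤N ⟩
    1           ∎

unit⇒coprime : ∀ {c d j N e} → c * d ≡ j * N + 1 → e ∣ c → e ∣ N → e ≡ 1
unit⇒coprime {d = d} {j} {e = e} cd≡jN+1 e∣c e∣N =
  ∣1⇒≡1 (∣m+n∣m⇒∣n (subst (e ∣_) cd≡jN+1 (∣m⇒∣m*n d e∣c)) (∣n⇒∣m*n j e∣N))

prime∣p*q⇒≡ : ∀ {r p q} → Prime r → Prime p → Prime q → r ∣ p * q → r ≡ p ⊎ r ≡ q
prime∣p*q⇒≡ r-prime p-prime q-prime r∣pq =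
  Sum.map (prime∣prime⇒≡ r-prime p-prime) (prime∣prime⇒≡ r-prime q-prime)
          (euclidsLemma _ _ r-prime r∣pq)

prime[3] : Prime 3
prime[3] = toWitness {a? = prime? 3} _

6≤p*q : ∀ {p q} → Prime p → Prime q → p ≢ q → 6 ≤ p * q
6≤p*q {p} p-prime q-prime p≢q with p ≟ 2
... | yes refl = *-monoʳ-≤ 2 (≤∧≢⇒< (prime⇒2≤ q-prime) p≢q)
... | no p≢2   = *-mono-≤ (≤∧≢⇒< (prime⇒2≤ p-prime) (≢-sym p≢2)) (prime⇒2≤ q-prime)

p*q≡6⇒p≡2⊎p≡3 : ∀ {p q} → Prime p → Prime q → p * q ≡ 6 → p ≡ 2 ⊎ p ≡ 3
p*q≡6⇒p≡2⊎p≡3 {p} {q} p-prime q-prime pq≡6 =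
  prime∣p*q⇒≡ p-prime prime[2] prime[3] (divides q (trans (sym pq≡6) (*-comm p q)))

p*q≢6⇒2∤⊎3∤ : ∀ {p q} → Prime p → Prime q → p * q ≢ 6 → 2 ∤ p * q ⊎ 3 ∤ p * q
p*q≢6⇒2∤⊎3∤ {p} {q} p-prime q-prime pq≢6 with 2 ∣? p * q | 3 ∣? p * q
... | no 2∤pq | _ = inj₁ 2∤pq
... | _ | no 3∤pq = inj₂ 3∤pq
... | yes 2∣pq | yes 3∣pq
  with prime∣p*q⇒≡ prime[2] p-prime q-prime 2∣pq | prime∣p*q⇒≡ prime[3] p-prime q-prime 3∣pq
...   | inj₁ refl | inj₂ refl = ⊥-elim (pq≢6 refl)
...   | inj₂ refl | inj₁ refl = ⊥-elim (pq≢6 refl)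
...   | inj₁ refl | inj₁ ()
...   | inj₂ refl | inj₂ ()

module _ {n : ℕ} .{{_ : NonZero n}} where

  PowerOf : ℕ → ℕ → Set
  PowerOf x y = ∃[ m ] (1 ≤ m × (m * x) % n ≡ y)

  powerOf⇒gcd∣ : ∀ {x y} → PowerOf x y → gcd x n ∣ y
  powerOf⇒gcd∣ {x} (m , _ , refl) =
    %-presˡ-∣ (∣n⇒∣m*n m (gcd[m,n]∣m x n)) (gcd[m,n]∣n x n)

  *-cong-% : ∀ c {a b} → a % n ≡ b % n → (c * a) % n ≡ (c * b) % n
  *-cong-% c {a} {b} a≡b = begin
    (c * a) % n                 ≡⟨ %-distribˡ-* c a n ⟩
    ((c % n) * (a % n)) % n     ≡⟨ cong (λ r → ((c % n) * r) % n) a≡b ⟩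
    ((c % n) * (b % n)) % n     ≡⟨ %-distribˡ-* c b n ⟨
    (c * b) % n                 ∎
    where open ≡-Reasoning

  -- The multiplier is shifted by n only to make it positive.
  gcd∣⇒powerOf : ∀ {x y} → y < n → gcd x n ∣ y → PowerOf x y
  gcd∣⇒powerOf {x} {y} y<n (divides c refl) with bézout-% n x
  ... | m , mx≡g = c * m + n , ≤-trans (>-nonZero⁻¹ n) (m≤n+m n (c * m)) , (begin
    ((c * m + n) * x) % n      ≡⟨ cong (_% n) (*-distribʳ-+ x (c * m) n) ⟩
    (c * m * x + n * x) % n    ≡⟨ cong (λ r → (c * m * x + r) % n) (*-comm n x) ⟩
    (c * m * x + x * n) % n    ≡⟨ [m+kn]%n≡m%n (c * m * x) x n ⟩
    (c * m * x) % n            ≡⟨ cong (_% n) (*-assoc c m x) ⟩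
    (c * (m * x)) % n          ≡⟨ *-cong-% c mx≡g ⟩
    (c * gcd x n) % n          ≡⟨ m<n⇒m%n≡m y<n ⟩
    c * gcd x n                ∎)
    where open ≡-Reasoning

-- Adjacency through gcds

AdjGcd : ℕ → ℕ → ℕ → Set
AdjGcd n x y = x ≢ y × (gcd x n ∣ y ⊎ gcd y n ∣ x)

AdjGcd-sym : ∀ {n x y} → AdjGcd n x y → AdjGcd n y x
AdjGcd-sym (x≢y , r) = x≢y ∘ sym , Sum.swap r

AdjGcd-irrefl : ∀ {n x} → ¬ AdjGcd n x x
AdjGcd-irrefl (x≢x , _) = x≢x refl

DominatingGcd : (n : ℕ) → ℕ → Set
DominatingGcd n x = (w : Fin n) → toℕ w ≢ x → AdjGcd n x (toℕ w)

Apart : ℕ → ℕ → ℕ → Set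
Apart n x y = ¬ gcd x n ∣ y × ¬ gcd y n ∣ x

apart⇒≢ : ∀ {n x y} → Apart n x y → x ≢ y
apart⇒≢ {n} {x} (x∤y , _) refl = x∤y (gcd[m,n]∣m x n)

apart⇒¬AdjGcd : ∀ {n x y} → Apart n x y → ¬ AdjGcd n x y
apart⇒¬AdjGcd (x∤y , y∤x) (_ , r) = Sum.[ x∤y , y∤x ] r

apart⇒¬dominating : ∀ {n x w} → w < n → Apart n x w → ¬ DominatingGcd n x
apart⇒¬dominating {x = x} w<n x⊥w dom =
  apart⇒¬AdjGcd x⊥w (subst (AdjGcd _ x) (Fin.toℕ-fromℕ< w<n) (dom w′ w′≢x))
  where
  w′ : Fin _
  w′ = fromℕ< w<n
  w′≢x : toℕ w′ ≢ x
  w′≢x = apart⇒≢ x⊥w ∘ sym ∘ trans (sym (Fin.toℕ-fromℕ< w<n))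

¬gcd∣ : ∀ {n d x y} → d ∣ x → d ∣ n → ¬ d ∣ y → ¬ gcd x n ∣ y
¬gcd∣ d∣x d∣n d∤y gcd∣y = d∤y (∣-trans (gcd-greatest d∣x d∣n) gcd∣y)

module _ {n : ℕ} .{{_ : NonZero n}} {u v : Fin n} where

  Adj⇒AdjGcd : Adj n u v → AdjGcd n (toℕ u) (toℕ v)
  Adj⇒AdjGcd (u≢v , r) = u≢v ∘ Fin.toℕ-injective , Sum.map powerOf⇒gcd∣ powerOf⇒gcd∣ r

  AdjGcd⇒Adj : AdjGcd n (toℕ u) (toℕ v) → Adj n u v
  AdjGcd⇒Adj (u≢v , r) =
    u≢v ∘ cong toℕ , Sum.map (gcd∣⇒powerOf (Fin.toℕ<n v)) (gcd∣⇒powerOf (Fin.toℕ<n u)) r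

module _ {n : ℕ} .{{_ : NonZero n}} {u : Fin n} where

  dominating⇒dominatingGcd : Dominating n u → DominatingGcd n (toℕ u)
  dominating⇒dominatingGcd dom w w≢u = Adj⇒AdjGcd (dom w (w≢u ∘ cong toℕ))

  dominatingGcd⇒dominating : DominatingGcd n (toℕ u) → Dominating n u
  dominatingGcd⇒dominating dom w w≢u = AdjGcd⇒Adj (dom w (w≢u ∘ Fin.toℕ-injective))

divisors-apart⇒¬dominating : ∀ {n d e} .{{_ : NonZero n}} → d ∣ n → e ∣ n → d ∤ e → e ∤ d →
  ¬ DominatingGcd n d
divisors-apart⇒¬dominating {d = d} {e} d∣n e∣n d∤e e∤d =
  apart⇒¬dominating e<n (¬gcd∣ ∣-refl d∣n d∤e , ¬gcd∣ ∣-refl e∣n e∤d)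
  where
  e<n : e < _
  e<n = ≤∧≢⇒< (∣⇒≤ e∣n) (λ e≡n → d∤e (subst (d ∣_) (sym e≡n) d∣n))

-- Induced copies of Γ₂

module _ {A : Set} (E : A → A → Set) where

  Γ₂-Induced : (Fin 5 → A) → Set
  Γ₂-Induced f = ∀ i j → i ≢ j → (E (f i) (f j) → Γ₂-Edge i j) × (Γ₂-Edge i j → E (f i) (f j))

  record Γ₂-Shape (f : Fin 5 → A) : Set where
    field
      0≢1 : f 0F ≢ f 1F
      0≁1 : ¬ E (f 0F) (f 1F)
      0∼2 : E (f 0F) (f 2F)
      0∼3 : E (f 0F) (f 3F)
      0∼4 : E (f 0F) (f 4F)
      1∼2 : E (f 1F) (f 2F)
      1∼3 : E (f 1F) (f 3F)
      1∼4 : E (f 1F) (f 4F)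
      2∼3 : E (f 2F) (f 3F)
      2∼4 : E (f 2F) (f 4F)
      3∼4 : E (f 3F) (f 4F)

module _ {A : Set} {E : A → A → Set} {f : Fin 5 → A} where

  induced⇒shape : (∀ i j → f i ≡ f j → i ≡ j) → Γ₂-Induced E f → Γ₂-Shape E f
  induced⇒shape f-injective induced = record
    { 0≢1 = λ f0≡f1 → 0≢1 (f-injective 0F 1F f0≡f1)
    ; 0≁1 = λ e → proj₁ (proj₂ (proj₁ (induced 0F 1F 0≢1) e)) (refl , refl)
    ; 0∼2 = edge ((λ ()) , (λ ()) , (λ ()))
    ; 0∼3 = edge ((λ ()) , (λ ()) , (λ ()))
    ; 0∼4 = edge ((λ ()) , (λ ()) , (λ ()))
    ; 1∼2 = edge ((λ ()) , (λ ()) , (λ ()))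
    ; 1∼3 = edge ((λ ()) , (λ ()) , (λ ()))
    ; 1∼4 = edge ((λ ()) , (λ ()) , (λ ()))
    ; 2∼3 = edge ((λ ()) , (λ ()) , (λ ()))
    ; 2∼4 = edge ((λ ()) , (λ ()) , (λ ()))
    ; 3∼4 = edge ((λ ()) , (λ ()) , (λ ()))
    }
    where
    0≢1 : 0F ≢ 1F
    0≢1 ()
    edge : ∀ {i j} → Γ₂-Edge i j → E (f i) (f j)
    edge {i} {j} e = proj₂ (induced i j (proj₁ e)) e

  module _ (E-sym : ∀ {x y} → E x y → E y x) (E-irrefl : ∀ {x} → ¬ E x x)
           (shape : Γ₂-Shape E f) where
    open Γ₂-Shape shape

    private
      Pair : Fin 5 → Fin 5 → Set
      Pair i j = (Γ₂-Edge i j × E (f i) (f j)) ⊎ (¬ Γ₂-Edge i j × f i ≢ f j × ¬ E (f i) (f j))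

      joined : ∀ {i j} → i ≢ j → (toℕ i ≡ 0 × toℕ j ≡ 1 → ⊥) → (toℕ i ≡ 1 × toℕ j ≡ 0 → ⊥) →
               E (f i) (f j) → Pair i j
      joined i≢j ¬01 ¬10 e = inj₁ ((i≢j , ¬01 , ¬10) , e)

      pair : ∀ i j → i ≢ j → Pair i j
      pair 0F 0F i≢j = ⊥-elim (i≢j refl)
      pair 0F 1F _   = inj₂ ((λ e → proj₁ (proj₂ e) (refl , refl)) , 0≢1 , 0≁1)
      pair 0F 2F i≢j = joined i≢j (λ ()) (λ ()) 0∼2
      pair 0F 3F i≢j = joined i≢j (λ ()) (λ ()) 0∼3
      pair 0F 4F i≢j = joined i≢j (λ ()) (λ ()) 0∼4
      pair 1F 0F _   = inj₂ ((λ e → proj₂ (proj₂ e) (refl , refl)) , 0≢1 ∘ sym , 0≁1 ∘ E-sym)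
      pair 1F 1F i≢j = ⊥-elim (i≢j refl)
      pair 1F 2F i≢j = joined i≢j (λ ()) (λ ()) 1∼2
      pair 1F 3F i≢j = joined i≢j (λ ()) (λ ()) 1∼3
      pair 1F 4F i≢j = joined i≢j (λ ()) (λ ()) 1∼4
      pair 2F 0F i≢j = joined i≢j (λ ()) (λ ()) (E-sym 0∼2)
      pair 2F 1F i≢j = joined i≢j (λ ()) (λ ()) (E-sym 1∼2)
      pair 2F 2F i≢j = ⊥-elim (i≢j refl)
      pair 2F 3F i≢j = joined i≢j (λ ()) (λ ()) 2∼3
      pair 2F 4F i≢j = joined i≢j (λ ()) (λ ()) 2∼4
      pair 3F 0F i≢j = joined i≢j (λ ()) (λ ()) (E-sym 0∼3)
      pair 3F 1F i≢j = joined i≢j (λ ()) (λ ()) (E-sym 1∼3)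
      pair 3F 2F i≢j = joined i≢j (λ ()) (λ ()) (E-sym 2∼3)
      pair 3F 3F i≢j = ⊥-elim (i≢j refl)
      pair 3F 4F i≢j = joined i≢j (λ ()) (λ ()) 3∼4
      pair 4F 0F i≢j = joined i≢j (λ ()) (λ ()) (E-sym 0∼4)
      pair 4F 1F i≢j = joined i≢j (λ ()) (λ ()) (E-sym 1∼4)
      pair 4F 2F i≢j = joined i≢j (λ ()) (λ ()) (E-sym 2∼4)
      pair 4F 3F i≢j = joined i≢j (λ ()) (λ ()) (E-sym 3∼4)
      pair 4F 4F i≢j = ⊥-elim (i≢j refl)

    shape⇒injective : ∀ i j → f i ≡ f j → i ≡ j
    shape⇒injective i j fi≡fj with i Fin.≟ j
    ... | yes i≡j = i≡j
    ... | no i≢j with pair i j i≢j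
    ...   | inj₁ (_ , e)         = ⊥-elim (E-irrefl (subst (E (f i)) (sym fi≡fj) e))
    ...   | inj₂ (_ , fi≢fj , _) = ⊥-elim (fi≢fj fi≡fj)

    shape⇒induced : Γ₂-Induced E f
    shape⇒induced i j i≢j with pair i j i≢j
    ... | inj₁ (edge , e)       = (λ _ → edge) , (λ _ → e)
    ... | inj₂ (¬edge , _ , ¬e) = ⊥-elim ∘ ¬e , ⊥-elim ∘ ¬edge

module _ {n : ℕ} .{{_ : NonZero n}} where

  containsΓ₂⇒shape : ContainsΓ₂ n →
    Σ[ f ∈ (Fin 5 → Fin n) ]
      ((∀ i → ¬ DominatingGcd n (toℕ (f i))) × Γ₂-Shape (AdjGcd n) (toℕ ∘ f))
  containsΓ₂⇒shape (f , f-injective , nondominating , induced) =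
    f , (λ i → nondominating i ∘ dominatingGcd⇒dominating) ,
    induced⇒shape (λ i j → f-injective i j ∘ Fin.toℕ-injective) induced-gcd
    where
    induced-gcd : Γ₂-Induced (AdjGcd n) (toℕ ∘ f)
    induced-gcd i j i≢j = let (to , from) = induced i j i≢j in
      to ∘ AdjGcd⇒Adj , Adj⇒AdjGcd ∘ from

  shape⇒containsΓ₂ : (v : Fin 5 → ℕ) → (∀ i → v i < n) →
    (∀ i → ¬ DominatingGcd n (v i)) → Γ₂-Shape (AdjGcd n) v → ContainsΓ₂ n
  shape⇒containsΓ₂ v v<n nondominating shape = f , f-injective , f-nondominating , f-induced
    where
    f : Fin 5 → Fin n
    f i = fromℕ< (v<n i)
    toℕ-f : ∀ i → toℕ (f i) ≡ v i
    toℕ-f i = Fin.toℕ-fromℕ< (v<n i)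
    f-injective : ∀ i j → f i ≡ f j → i ≡ j
    f-injective i j fi≡fj = shape⇒injective AdjGcd-sym AdjGcd-irrefl shape i j
      (trans (sym (toℕ-f i)) (trans (cong toℕ fi≡fj) (toℕ-f j)))
    f-nondominating : ∀ i → ¬ Dominating n (f i)
    f-nondominating i =
      nondominating i ∘ subst (DominatingGcd n) (toℕ-f i) ∘ dominating⇒dominatingGcd
    f-induced : Γ₂-Induced (Adj n) f
    f-induced i j i≢j = let (to , from) = shape⇒induced AdjGcd-sym AdjGcd-irrefl shape i j i≢j in
      to ∘ subst₂ (AdjGcd n) (toℕ-f i) (toℕ-f j) ∘ Adj⇒AdjGcd ,
      AdjGcd⇒Adj ∘ subst₂ (AdjGcd n) (sym (toℕ-f i)) (sym (toℕ-f j)) ∘ from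

-- Orders without an induced Γ₂

module _ {n : ℕ} where

  divisor-chain⇒dominating : (∀ {d e} → d ∣ n → e ∣ n → d ∣ e ⊎ e ∣ d) → ∀ x → DominatingGcd n x
  divisor-chain⇒dominating chain x w w≢x =
    w≢x ∘ sym ,
    Sum.map (λ d → ∣-trans d (gcd[m,n]∣m (toℕ w) n)) (λ d → ∣-trans d (gcd[m,n]∣m x n))
            (chain (gcd[m,n]∣n x n) (gcd[m,n]∣n (toℕ w) n))

  gcd≡1⇒dominating : ∀ {x} → gcd x n ≡ 1 → DominatingGcd n x
  gcd≡1⇒dominating g≡1 w w≢x = w≢x ∘ sym , inj₁ (subst (_∣ toℕ w) (sym g≡1) (1∣ toℕ w))

  n∣⇒dominating : ∀ {x} → n ∣ x → DominatingGcd n x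
  n∣⇒dominating n∣x w w≢x = w≢x ∘ sym , inj₂ (∣-trans (gcd[m,n]∣n (toℕ w) n) n∣x)

  prime-gcd-adjacent⇒≡ : ∀ {x y} → Prime (gcd x n) → Prime (gcd y n) → AdjGcd n x y →
    gcd x n ≡ gcd y n
  prime-gcd-adjacent⇒≡ {x} {y} x-prime y-prime (_ , inj₁ gx∣y) =
    prime∣prime⇒≡ x-prime y-prime (gcd-greatest gx∣y (gcd[m,n]∣n x n))
  prime-gcd-adjacent⇒≡ {x} {y} x-prime y-prime (_ , inj₂ gy∣x) =
    sym (prime∣prime⇒≡ y-prime x-prime (gcd-greatest gy∣x (gcd[m,n]∣n y n)))

  -- Adjacent non-dominating vertices share their prime gcd with n, so 0 and 1, having the
  -- common neighbour 2, would be adjacent.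
  prime-gcds⇒noΓ₂ : .{{_ : NonZero n}} → (∀ {x} → ¬ DominatingGcd n x → Prime (gcd x n)) →
    ¬ ContainsΓ₂ n
  prime-gcds⇒noΓ₂ prime-gcd contains with containsΓ₂⇒shape contains
  ... | f , nondominating , shape = 0≁1 (0≢1 , inj₁ g0∣v1)
    where
    open Γ₂-Shape shape
    v : Fin 5 → ℕ
    v = toℕ ∘ f
    g≡ : ∀ {i j} → AdjGcd n (v i) (v j) → gcd (v i) n ≡ gcd (v j) n
    g≡ {i} {j} = prime-gcd-adjacent⇒≡ (prime-gcd (nondominating i)) (prime-gcd (nondominating j))
    g0∣v1 : gcd (v 0F) n ∣ v 1F
    g0∣v1 = subst (_∣ v 1F) (trans (g≡ 1∼2) (sym (g≡ 0∼2))) (gcd[m,n]∣m (v 1F) n)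

prime^⇒noΓ₂ : ∀ {n p t} .{{_ : NonZero n}} → Prime p → n ≡ p ^ t → ¬ ContainsΓ₂ n
prime^⇒noΓ₂ {t = t} p-prime refl contains with containsΓ₂⇒shape contains
... | f , nondominating , _ =
  nondominating 0F (divisor-chain⇒dominating (prime^-divisors-chain p-prime t) _)

p*q⇒noΓ₂ : ∀ {n p q} .{{_ : NonZero n}} → Prime p → Prime q → n ≡ p * q → ¬ ContainsΓ₂ n
p*q⇒noΓ₂ {n} p-prime q-prime n≡pq = prime-gcds⇒noΓ₂ prime-gcd
  where
  prime-gcd : ∀ {x} → ¬ DominatingGcd n x → Prime (gcd x n)
  prime-gcd {x} nondominating =
    ∣p*q⇒prime p-prime q-prime (subst (gcd x n ∣_) n≡pq (gcd[m,n]∣n x n))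
      (nondominating ∘ gcd≡1⇒dominating)
      (λ g≡pq → nondominating (n∣⇒dominating
        (subst (_∣ x) (trans g≡pq (sym n≡pq)) (gcd[m,n]∣m x n))))

AdjGcd? : ∀ n x y → Dec (AdjGcd n x y)
AdjGcd? n x y = ¬? (x ≟ y) ×-dec (gcd x n ∣? y ⊎-dec gcd y n ∣? x)

DominatingGcd? : ∀ n x → Dec (DominatingGcd n x)
DominatingGcd? n x = Fin.all? λ w → ¬? (toℕ w ≟ x) →-dec AdjGcd? n x (toℕ w)

-- Curried in this order so that deciding it abandons a partial choice of a, b, x, y as soon
-- as one hypothesis fails.
NoΓ₂Shape : ℕ → Set
NoΓ₂Shape n =
  (a b : Fin n) → toℕ a ≢ toℕ b → ¬ E a b → ¬ D a → ¬ D b →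
  (x : Fin n) → E a x → E b x → ¬ D x →
  (y : Fin n) → E a y → E b y → E x y → ¬ D y →
  (z : Fin n) → E a z → E b z → E x z → E y z → ¬ D z → ⊥
  where
  E : Fin n → Fin n → Set
  E u v = AdjGcd n (toℕ u) (toℕ v)
  D : Fin n → Set
  D u = DominatingGcd n (toℕ u)

noΓ₂Shape? : ∀ n → Dec (NoΓ₂Shape n)
noΓ₂Shape? n =
  all? λ a → all? λ b → ¬? (toℕ a ≟ toℕ b) →-dec ¬? (E? a b) →-dec ¬? (D? a) →-dec ¬? (D? b) →-dec
  all? λ x → E? a x →-dec E? b x →-dec ¬? (D? x) →-dec
  all? λ y → E? a y →-dec E? b y →-dec E? x y →-dec ¬? (D? y) →-dec
  all? λ z → E? a z →-dec E? b z →-dec E? x z →-dec E? y z →-dec ¬? (D? z) →-dec no id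
  where
  all? : ∀ {P : Fin n → Set} → (∀ u → Dec (P u)) → Dec (∀ u → P u)
  all? = Fin.all?
  E? : ∀ u v → Dec (AdjGcd n (toℕ u) (toℕ v))
  E? u v = AdjGcd? n (toℕ u) (toℕ v)
  D? : ∀ u → Dec (DominatingGcd n (toℕ u))
  D? u = DominatingGcd? n (toℕ u)

noΓ₂Shape⇒noΓ₂ : ∀ {n} .{{_ : NonZero n}} → NoΓ₂Shape n → ¬ ContainsΓ₂ n
noΓ₂Shape⇒noΓ₂ noShape contains with containsΓ₂⇒shape contains
... | f , nd , shape =
  noShape (f 0F) (f 1F) 0≢1 0≁1 (nd 0F) (nd 1F)
          (f 2F) 0∼2 1∼2 (nd 2F)
          (f 3F) 0∼3 1∼3 2∼3 (nd 3F)
          (f 4F) 0∼4 1∼4 2∼4 3∼4 (nd 4F)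
  where open Γ₂-Shape shape

noΓ₂[12] : ¬ ContainsΓ₂ 12
noΓ₂[12] = noΓ₂Shape⇒noΓ₂ (toWitness {a? = noΓ₂Shape? 12} _)

noΓ₂[18] : ¬ ContainsΓ₂ 18
noΓ₂[18] = noΓ₂Shape⇒noΓ₂ (toWitness {a? = noΓ₂Shape? 18} _)

-- A copy of Γ₂ inside the subgroup pℤ_n

-- The five vertices are p·a, p·b, p, −p = p·N′ and p·c in the cyclic subgroup pℤ_n ≅ ℤ_N: the
-- generators p and −p of that subgroup are adjacent to all of it, while p·a and p·b generate
-- incomparable subgroups.
module Subgroup {n p a b N : ℕ} .{{_ : NonZero n}}
  (p-prime : Prime p) (a-prime : Prime a) (b-prime : Prime b) (a≢b : a ≢ b) (b≢p : b ≢ p)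
  (n≡pN : n ≡ p * N) (ab∣N : a * b ∣ N) where

  instance
    p≢0 : NonZero p
    p≢0 = prime⇒nonZero p-prime
    a≢0 : NonZero a
    a≢0 = prime⇒nonZero a-prime
    b≢0 : NonZero b
    b≢0 = prime⇒nonZero b-prime
    N≢0 : NonZero N
    N≢0 = ≢-nonZero λ N≡0 → ≢-nonZero⁻¹ n (trans n≡pN (trans (cong (p *_) N≡0) (*-zeroʳ p)))

  N′ : ℕ
  N′ = pred N

  N≡1+N′ : N ≡ suc N′
  N≡1+N′ = sym (suc-pred N)

  2≤a : 2 ≤ a
  2≤a = prime⇒2≤ a-prime

  2≤b : 2 ≤ b
  2≤b = prime⇒2≤ b-prime

  factor<N′ : ∀ {x y} → 2 ≤ x → 2 ≤ y → x * y ∣ N → x < N′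
  factor<N′ {x} 2≤x 2≤y xy∣N = s≤s⁻¹ (subst (2 + x ≤_) N≡1+N′ (2+factor≤ 2≤x 2≤y xy∣N))

  a<N′ : a < N′
  a<N′ = factor<N′ 2≤a 2≤b ab∣N

  b<N′ : b < N′
  b<N′ = factor<N′ 2≤b 2≤a (subst (_∣ N) (*-comm a b) ab∣N)

  1<N′ : 1 < N′
  1<N′ = <-trans 2≤a a<N′

  <N′⇒<N : ∀ {k} → k < N′ → k < N
  <N′⇒<N k<N′ = subst (_ <_) (sym N≡1+N′) (m<n⇒m<1+n k<N′)

  p*<n : ∀ {k} → k < N → p * k < n
  p*<n k<N = subst (p * _ <_) (sym n≡pN) (*-monoʳ-< p k<N)

  p*-≢ : ∀ {x y} → x ≢ y → p * x ≢ p * y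
  p*-≢ x≢y = x≢y ∘ *-cancelˡ-≡ _ _ p

  ∣N⇒∣n : ∀ {d} → d ∣ N → d ∣ n
  ∣N⇒∣n d∣N = subst (_ ∣_) (sym n≡pN) (∣n⇒∣m*n p d∣N)

  p*∣n : ∀ {k} → k ∣ N → p * k ∣ n
  p*∣n k∣N = subst (_ ∣_) (sym n≡pN) (*-monoʳ-∣ p k∣N)

  p∤b : p ∤ b
  p∤b = b≢p ∘ sym ∘ prime∣prime⇒≡ p-prime b-prime

  b∤p : b ∤ p
  b∤p = b≢p ∘ prime∣prime⇒≡ b-prime p-prime

  -- g generates the subgroup pℤ_n
  Generator : ℕ → Set
  Generator g = gcd g n ≡ p

  generator : ∀ {g} → p ∣ g → gcd g n ∣ p → Generator g
  generator p∣g g∣p = ∣-antisym g∣p (gcd-greatest p∣g p∣n)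
    where
    p∣n : p ∣ n
    p∣n = subst (p ∣_) (sym n≡pN) (m∣m*n N)

  generator[p] : Generator (p * 1)
  generator[p] = generator (m∣m*n 1)
    (subst (gcd (p * 1) n ∣_) (*-identityʳ p) (gcd[m,n]∣m (p * 1) n))

  generator[-p] : Generator (p * N′)
  generator[-p] = generator (m∣m*n N′)
    (∣m+n∣m⇒∣n (subst (gcd (p * N′) n ∣_) n≡pN′+p (gcd[m,n]∣n (p * N′) n))
               (gcd[m,n]∣m (p * N′) n))
    where
    n≡pN′+p : n ≡ p * N′ + p
    n≡pN′+p = begin
      n            ≡⟨ n≡pN ⟩
      p * N        ≡⟨ cong (p *_) N≡1+N′ ⟩
      p * suc N′   ≡⟨ *-suc p N′ ⟩
      p + p * N′   ≡⟨ +-comm p (p * N′) ⟩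
      p * N′ + p   ∎
      where open ≡-Reasoning

  generator∼ : ∀ {g k} → Generator g → g ≢ p * k → AdjGcd n g (p * k)
  generator∼ {k = k} g-gen g≢pk = g≢pk , inj₁ (subst (_∣ p * k) (sym g-gen) (m∣m*n k))

  generator-nondominating : ∀ {g} → Generator g → ¬ DominatingGcd n g
  generator-nondominating {g} g-gen =
    apart⇒¬dominating b<n (p∤b ∘ subst (_∣ b) g-gen , ¬gcd∣ ∣-refl b∣n b∤g)
    where
    b∣n : b ∣ n
    b∣n = ∣N⇒∣n (m*n∣⇒n∣ a b ab∣N)
    b∤g : b ∤ g
    b∤g b∣g = b∤p (subst (b ∣_) g-gen (gcd-greatest b∣g b∣n))
    b<n : b < n
    b<n = <-≤-trans (<N′⇒<N b<N′) (subst (N ≤_) (sym n≡pN) (m≤n*m N p))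

  subgroup-Γ₂ : ∀ {c} → 1 < c → c < N′ → AdjGcd n (p * a) (p * c) → AdjGcd n (p * b) (p * c) →
    ¬ DominatingGcd n (p * c) → ContainsΓ₂ n
  subgroup-Γ₂ {c} 1<c c<N′ a∼c b∼c c-nondominating =
    shape⇒containsΓ₂ (λ i → p * cofactor i) (p*<n ∘ cofactor<N) nondominating shape
    where
    cofactor : Fin 5 → ℕ
    cofactor 0F = a
    cofactor 1F = b
    cofactor 2F = 1
    cofactor 3F = N′
    cofactor 4F = c

    cofactor<N : ∀ i → cofactor i < N
    cofactor<N 0F = <N′⇒<N a<N′
    cofactor<N 1F = <N′⇒<N b<N′
    cofactor<N 2F = <N′⇒<N 1<N′
    cofactor<N 3F = subst (N′ <_) (sym N≡1+N′) ≤-refl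
    cofactor<N 4F = <N′⇒<N c<N′

    a∤b : a ∤ b
    a∤b = a≢b ∘ prime∣prime⇒≡ a-prime b-prime

    b∤a : b ∤ a
    b∤a = a≢b ∘ sym ∘ prime∣prime⇒≡ b-prime a-prime

    pa∣n : p * a ∣ n
    pa∣n = p*∣n (m*n∣⇒m∣ a b ab∣N)

    pb∣n : p * b ∣ n
    pb∣n = p*∣n (m*n∣⇒n∣ a b ab∣N)

    a⊥b : Apart n (p * a) (p * b)
    a⊥b = ¬gcd∣ ∣-refl pa∣n (a∤b ∘ *-cancelˡ-∣ p) , ¬gcd∣ ∣-refl pb∣n (b∤a ∘ *-cancelˡ-∣ p)

    nondominating : ∀ i → ¬ DominatingGcd n (p * cofactor i)
    nondominating 0F = apart⇒¬dominating (p*<n (cofactor<N 1F)) a⊥b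
    nondominating 1F = apart⇒¬dominating (p*<n (cofactor<N 0F)) (swap a⊥b)
    nondominating 2F = generator-nondominating generator[p]
    nondominating 3F = generator-nondominating generator[-p]
    nondominating 4F = c-nondominating

    shape : Γ₂-Shape (AdjGcd n) (λ i → p * cofactor i)
    shape = record
      { 0≢1 = p*-≢ a≢b
      ; 0≁1 = apart⇒¬AdjGcd a⊥b
      ; 0∼2 = AdjGcd-sym (generator∼ generator[p] (p*-≢ (<⇒≢ 2≤a)))
      ; 0∼3 = AdjGcd-sym (generator∼ generator[-p] (p*-≢ (≢-sym (<⇒≢ a<N′))))
      ; 0∼4 = a∼c
      ; 1∼2 = AdjGcd-sym (generator∼ generator[p] (p*-≢ (<⇒≢ 2≤b)))
      ; 1∼3 = AdjGcd-sym (generator∼ generator[-p] (p*-≢ (≢-sym (<⇒≢ b<N′))))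
      ; 1∼4 = b∼c
      ; 2∼3 = generator∼ generator[p] (p*-≢ (<⇒≢ 1<N′))
      ; 2∼4 = generator∼ generator[p] (p*-≢ (<⇒≢ 1<c))
      ; 3∼4 = generator∼ generator[-p] (p*-≢ (≢-sym (<⇒≢ c<N′)))
      }

  composite-cofactor-Γ₂ : ∀ {k} → N ≡ a * b * k → 2 ≤ k → ContainsΓ₂ n
  composite-cofactor-Γ₂ {k} N≡abk 2≤k with prime-factor 2≤k
  ... | t , t-prime , t∣k = subgroup-Γ₂ 2≤ab ab<N′ a∼ab b∼ab ab-nondominating
    where
    instance
      ab≢0 : NonZero (a * b)
      ab≢0 = m*n≢0 a b
    2≤ab : 2 ≤ a * b
    2≤ab = ≤-trans 2≤a (m≤m*n a b)
    ab<N′ : a * b < N′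
    ab<N′ = factor<N′ 2≤ab 2≤k (∣-reflexive (sym N≡abk))
    a∼ab : AdjGcd n (p * a) (p * (a * b))
    a∼ab = p*-≢ (<⇒≢ (m<m*n a b 2≤b)) , inj₁ (∣-trans (gcd[m,n]∣m _ n) (*-monoʳ-∣ p (m∣m*n b)))
    b∼ab : AdjGcd n (p * b) (p * (a * b))
    b∼ab = p*-≢ (<⇒≢ (subst (b <_) (*-comm b a) (m<m*n b a 2≤a))) ,
           inj₁ (∣-trans (gcd[m,n]∣m _ n) (*-monoʳ-∣ p (n∣m*n a)))
    pab∣n : p * (a * b) ∣ n
    pab∣n = p*∣n ab∣N
    -- A divisor of n = p·a·b·k incomparable with p·a·b: a·b·t, or p·a·p when t = p.
    ab-nondominating : ¬ DominatingGcd n (p * (a * b))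
    ab-nondominating with t ≟ p
    ... | no t≢p = divisors-apart⇒¬dominating pab∣n abt∣n pab∤abt abt∤pab
      where
      abt∣n : a * b * t ∣ n
      abt∣n = ∣N⇒∣n (subst (a * b * t ∣_) (sym N≡abk) (*-monoʳ-∣ (a * b) t∣k))
      pab∤abt : p * (a * b) ∤ a * b * t
      pab∤abt = t≢p ∘ sym ∘ prime∣prime⇒≡ p-prime t-prime ∘ *-cancelˡ-∣ (a * b)
              ∘ subst (_∣ a * b * t) (*-comm p (a * b))
      abt∤pab : a * b * t ∤ p * (a * b)
      abt∤pab = t≢p ∘ prime∣prime⇒≡ t-prime p-prime ∘ *-cancelˡ-∣ (a * b)
              ∘ subst (a * b * t ∣_) (*-comm p (a * b))
    ... | yes refl = divisors-apart⇒¬dominating pab∣n pap∣n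
          (b∤p ∘ *-cancelˡ-∣ a ∘ *-cancelˡ-∣ p)
          (p∤b ∘ *-cancelˡ-∣ a ∘ *-cancelˡ-∣ p)
      where
      pap∣n : p * (a * p) ∣ n
      pap∣n = p*∣n (subst (a * p ∣_) (trans (sym (*-assoc a b k)) (sym N≡abk))
                          (*-monoʳ-∣ a (∣n⇒∣m*n b t∣k)))

  prime-unit-cofactor-Γ₂ : ∀ {c} → Prime c → c ≤ 3 → 6 ≤ N → c ∤ N → ContainsΓ₂ n
  prime-unit-cofactor-Γ₂ {c} c-prime c≤3 6≤N c∤N
    with ∤prime⇒unit (≤-trans (s≤s (s≤s z≤n)) 6≤N) c-prime c∤N
  ... | d , j , cd≡jN+1 = subgroup-Γ₂ (prime⇒2≤ c-prime) c<N′
        (AdjGcd-sym (generator∼ pc-generator (p*-≢ c≢a)))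
        (AdjGcd-sym (generator∼ pc-generator (p*-≢ c≢b)))
        (generator-nondominating pc-generator)
    where
    c<N′ : c < N′
    c<N′ = ≤-trans (s≤s c≤3) (≤-trans (n≤1+n 4) (pred-mono-≤ 6≤N))
    c≢ : ∀ {q} → Prime q → q ∣ N → c ≢ q
    c≢ q-prime q∣N refl =
      ¬prime[1] (subst Prime (unit⇒coprime {j = j} cd≡jN+1 ∣-refl q∣N) q-prime)
    c≢a : c ≢ a
    c≢a = c≢ a-prime (m*n∣⇒m∣ a b ab∣N)
    c≢b : c ≢ b
    c≢b = c≢ b-prime (m*n∣⇒n∣ a b ab∣N)
    pcd≡jn+p : p * c * d ≡ j * n + p
    pcd≡jn+p = begin
      p * c * d       ≡⟨ *-assoc p c d ⟩
      p * (c * d)     ≡⟨ cong (p *_) cd≡jN+1 ⟩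
      p * (j * N + 1) ≡⟨ distribute p j N ⟩
      j * (p * N) + p ≡⟨ cong (λ m → j * m + p) n≡pN ⟨
      j * n + p       ∎
      where
      open ≡-Reasoning
      distribute : ∀ p j N → p * (j * N + 1) ≡ j * (p * N) + p
      distribute = solve-∀
    -- p·c·d ≡ p (mod n), so p·c generates the same subgroup as p.
    pc-generator : Generator (p * c)
    pc-generator = generator (m∣m*n c)
      (∣m+n∣m⇒∣n (subst (gcd (p * c) n ∣_) pcd≡jn+p (∣m⇒∣m*n d (gcd[m,n]∣m (p * c) n)))
                 (∣n⇒∣m*n j (gcd[m,n]∣n (p * c) n)))

  unit-cofactor-Γ₂ : N ≡ a * b → a * b ≢ 6 → ContainsΓ₂ n
  unit-cofactor-Γ₂ N≡ab ab≢6 =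
    Sum.[ prime-unit-cofactor-Γ₂ prime[2] (s≤s (s≤s z≤n)) 6≤N ∘ ∤N
        , prime-unit-cofactor-Γ₂ prime[3] ≤-refl 6≤N ∘ ∤N
        ] (p*q≢6⇒2∤⊎3∤ a-prime b-prime ab≢6)
    where
    6≤N : 6 ≤ N
    6≤N = subst (6 ≤_) (sym N≡ab) (6≤p*q a-prime b-prime a≢b)
    ∤N : ∀ {c} → c ∤ a * b → c ∤ N
    ∤N {c} = subst (c ∤_) (sym N≡ab)

factorisation⇒containsΓ₂ : ∀ {n p a b k} .{{_ : NonZero n}} →
  Prime p → Prime a → Prime b → a ≢ b → b ≢ p →
  n ≡ p * (a * b * k) → (k ≡ 1 → a * b ≢ 6) → ContainsΓ₂ n
factorisation⇒containsΓ₂ {n} {p} {a} {b} {zero} _ _ _ _ _ n≡0 _ =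
  ⊥-elim (≢-nonZero⁻¹ n (trans n≡0 (trans (cong (p *_) (*-zeroʳ (a * b))) (*-zeroʳ p))))
factorisation⇒containsΓ₂ {k = 1} p-prime a-prime b-prime a≢b b≢p n≡pab1 ab≢6 =
  unit-cofactor-Γ₂ (*-identityʳ _) (ab≢6 refl)
  where open Subgroup p-prime a-prime b-prime a≢b b≢p n≡pab1 (m∣m*n 1)
factorisation⇒containsΓ₂ {k = suc (suc k)} p-prime a-prime b-prime a≢b b≢p n≡pabk _ =
  composite-cofactor-Γ₂ refl (s≤s (s≤s z≤n))
  where open Subgroup p-prime a-prime b-prime a≢b b≢p n≡pabk (m∣m*n (suc (suc k)))

-- Classification of the orders

PrimePower : ℕ → Set
PrimePower n = ∃[ p ] ∃[ t ] (Prime p × 1 ≤ t × n ≡ p ^ t)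

TwoPrimeDivisors : ℕ → Set
TwoPrimeDivisors n = ∃[ p ] ∃[ q ] (Prime p × Prime q × p ≢ q × p * q ∣ n)

primePower⊎twoPrimeDivisors : ∀ n → 2 ≤ n → PrimePower n ⊎ TwoPrimeDivisors n
primePower⊎twoPrimeDivisors = <-rec _ step
  where
  step : ∀ n → (∀ {m} → m < n → 2 ≤ m → PrimePower m ⊎ TwoPrimeDivisors m) →
    2 ≤ n → PrimePower n ⊎ TwoPrimeDivisors n
  step n rec 2≤n with prime-factor 2≤n
  ... | q , q-prime , divides m n≡mq with m
  ...   | 0 = ⊥-elim (<⇒≢ (≤-trans (s≤s z≤n) 2≤n) (sym n≡mq))
  ...   | 1 = inj₁ (q , 1 , q-prime , ≤-refl , trans n≡mq (*-comm 1 q))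
  ...   | m@(suc (suc _)) with rec (subst (m <_) (sym n≡mq) (m<m*n m q (prime⇒2≤ q-prime)))
                                  (s≤s (s≤s z≤n))
  ...     | inj₂ (p , p′ , p-prime , p′-prime , p≢p′ , pp′∣m) =
    inj₂ (p , p′ , p-prime , p′-prime , p≢p′ , ∣-trans pp′∣m (divides q (trans n≡mq (*-comm m q))))
  ...     | inj₁ (r , suc t , r-prime , _ , m≡r^t) with r ≟ q
  ...       | yes refl =
    inj₁ (r , suc (suc t) , r-prime , s≤s z≤n ,
          trans n≡mq (trans (cong (_* r) m≡r^t) (*-comm (r ^ suc t) r)))
  ...       | no r≢q =
    inj₂ (r , q , r-prime , q-prime , r≢q ,
          subst (r * q ∣_) (sym n≡mq) (*-monoˡ-∣ q (subst (r ∣_) (sym m≡r^t) (m∣m*n (r ^ t)))))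

classify-p²qk : ∀ {n p q k} .{{_ : NonZero n}} → Prime p → Prime q → p ≢ q →
  n ≡ p * (p * q * k) → Exceptional n ⊎ ContainsΓ₂ n
classify-p²qk {n} {p} {q} {k} p-prime q-prime p≢q n≡ppqk with (k ≟ 1) ×-dec (p * q ≟ 6)
... | yes (refl , pq≡6) = inj₁ (inj₂ (inj₂
        (Sum.map (λ p≡2 → trans n≡p6 (cong (_* 6) p≡2)) (λ p≡3 → trans n≡p6 (cong (_* 6) p≡3))
                 (p*q≡6⇒p≡2⊎p≡3 p-prime q-prime pq≡6))))
  where
  n≡p6 : n ≡ p * 6
  n≡p6 = trans n≡ppqk (cong (p *_) (trans (*-identityʳ (p * q)) pq≡6))
... | no ¬[k≡1×pq≡6] =
  inj₂ (factorisation⇒containsΓ₂ p-prime p-prime q-prime p≢q (≢-sym p≢q) n≡ppqk (curry ¬[k≡1×pq≡6]))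

distinct-primes⇒containsΓ₂ : ∀ {n p q r k} .{{_ : NonZero n}} → Prime p → Prime q → Prime r →
  p ≢ q → q ≢ r → r ≢ p → n ≡ k * r * (p * q) → ContainsΓ₂ n
distinct-primes⇒containsΓ₂ {n} {p} {q} {r} {k} p-prime q-prime r-prime p≢q q≢r r≢p n≡krpq
  with (k ≟ 1) ×-dec (q * r ≟ 6)
... | yes (refl , qr≡6) =
  -- p·r ≡ 6 ≡ q·r would force p ≡ q, so p and q can exchange roles.
  factorisation⇒containsΓ₂ q-prime p-prime r-prime (≢-sym r≢p) (≢-sym q≢r)
    (trans n≡krpq (rearrange p q r))
    (λ _ pr≡6 → p≢q (*-cancelʳ-≡ p q r {{prime⇒nonZero r-prime}} (trans pr≡6 (sym qr≡6))))
  where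
  rearrange : ∀ p q r → 1 * r * (p * q) ≡ q * (p * r * 1)
  rearrange = solve-∀
... | no ¬[k≡1×qr≡6] =
  factorisation⇒containsΓ₂ p-prime q-prime r-prime q≢r r≢p
    (trans n≡krpq (rearrange p q r k)) (curry ¬[k≡1×qr≡6])
  where
  rearrange : ∀ p q r k → k * r * (p * q) ≡ p * (q * r * k)
  rearrange = solve-∀

classify-pqrk : ∀ {n p q r k} .{{_ : NonZero n}} → Prime p → Prime q → Prime r → p ≢ q →
  n ≡ k * r * (p * q) → Exceptional n ⊎ ContainsΓ₂ n
classify-pqrk {n} {p} {q} {r} {k} p-prime q-prime r-prime p≢q n≡krpq with r ≟ p | r ≟ q
... | yes refl | _ = classify-p²qk p-prime q-prime p≢q (trans n≡krpq (rearrange k p q))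
  where
  rearrange : ∀ k p q → k * p * (p * q) ≡ p * (p * q * k)
  rearrange = solve-∀
... | _ | yes refl = classify-p²qk q-prime p-prime (≢-sym p≢q) (trans n≡krpq (rearrange k p q))
  where
  rearrange : ∀ k p q → k * q * (p * q) ≡ q * (q * p * k)
  rearrange = solve-∀
... | no r≢p | no r≢q =
  inj₂ (distinct-primes⇒containsΓ₂ {k = k} p-prime q-prime r-prime p≢q (≢-sym r≢q) r≢p n≡krpq)

classify : ∀ {n} .{{_ : NonZero n}} → 2 ≤ n → Exceptional n ⊎ ContainsΓ₂ n
classify {n} 2≤n with primePower⊎twoPrimeDivisors n 2≤n
... | inj₁ n-prime-power = inj₁ (inj₁ n-prime-power)
... | inj₂ (p , q , p-prime , q-prime , p≢q , divides m n≡m*pq) with m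
...   | 0 = ⊥-elim (≢-nonZero⁻¹ n n≡m*pq)
...   | 1 =
  inj₁ (inj₂ (inj₁ (p , q , p-prime , q-prime , p≢q , trans n≡m*pq (*-identityˡ (p * q)))))
...   | suc (suc m) with prime-factor {suc (suc m)} (s≤s (s≤s z≤n))
...     | r , r-prime , divides k m≡kr =
  classify-pqrk {k = k} p-prime q-prime r-prime p≢q (trans n≡m*pq (cong (_* (p * q)) m≡kr))

exceptional⇒noΓ₂ : ∀ {n} .{{_ : NonZero n}} → Exceptional n → ¬ ContainsΓ₂ n
exceptional⇒noΓ₂ (inj₁ (_ , t , p-prime , _ , n≡p^t)) = prime^⇒noΓ₂ {t = t} p-prime n≡p^t
exceptional⇒noΓ₂ (inj₂ (inj₁ (_ , _ , p-prime , q-prime , _ , n≡pq))) =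
  p*q⇒noΓ₂ p-prime q-prime n≡pq
exceptional⇒noΓ₂ (inj₂ (inj₂ (inj₁ refl))) = noΓ₂[12]
exceptional⇒noΓ₂ (inj₂ (inj₂ (inj₂ refl))) = noΓ₂[18]

mainTheorem12 : (n : ℕ) → .{{_ : NonZero n}} → 2 ≤ n →
    ((¬ ContainsΓ₂ n → Exceptional n) × (Exceptional n → ¬ ContainsΓ₂ n))
mainTheorem12 n 2≤n = (λ noΓ₂ → Sum.[ id , ⊥-elim ∘ noΓ₂ ] (classify 2≤n)) , exceptional⇒noΓ₂
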